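{- Let $P$ and $Q$ be lattice paths from $(0,0)$ to $(m,r)$ with steps $E=(1,0)$ and $N=(0,1)$, with $P$ never going above $Q$, and let $k$ be the number of lattice points that lie on both $P$ and $Q$ (including $(0,0)$ and $(m,r)$). Then the dimension of the lattice path matroid polytope $\mathcal{P}(\mathcal{M}[P,Q])\subset\mathbb{R}^{m+r}$ is $m+r-k+1$.
   Context: Lattice paths are written as words in $\{E,N\}$. For lattice paths $P,Q$ from $(0,0)$ to $(m,r)$ with $P$ never above $Q$, let $u_1<\dots<u_r$ be the positions of the North steps of $P$ and $l_1<\dots<l_r$ the positions of the North steps of $Q$, and $N_i=[l_i,u_i]\cap\mathbb{Z}$. The matroid $\mathcal{M}[P,Q]$ is the transversal matroid on ground set $[m+r]$ with presentation $(N_i:i\in[r])$; equivalently, an $r$-subset $B\subseteq[m+r]$ is a basis iff the lattice path having North steps exactly at the positions in $B$ (and East steps elsewhere) stays in the region bounded by $P$ and $Q$. For a matroid $\mathcal{M}$ on $[n]$, its matroid polytope is $\mathcal{P}(\mathcal{M})=\mathrm{conv}\{e_B : B \text{ a basis}\}\subset\mathbb{R}^n$, where $e_B=\sum_{i\in B}e_i$.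
   Formalization: The polytope $\mathcal{P}(\mathcal{M}[P,Q])$ is taken over the rationals, as the rational convex combinations of the vectors $e_B$ in ℚ^(m+r) rather than a subset of ℝ^(m+r). -}

module Defs where

open import Data.Nat using (ℕ; zero; suc; _∸_; _≤_; _≟_)
open import Data.Product.Properties using (≡-dec)
open import Data.Bool using (Bool; true; false)
open import Data.Fin using (Fin; zero; suc)
open import Data.Fin.Subset using (Subset; ∣_∣)
open import Data.Vec using (Vec; []; _∷_; toList; lookup; map)
open import Data.List using (List; take; upTo; filter; length)
import Data.List as List
open import Data.Product using (Σ; _×_; _,_)
open import Data.Rational using (ℚ; 0ℚ; 1ℚ) renaming (_+_ to _+ℚ_; _*_ to _*ℚ_; _≤_ to _≤ℚ_)
open import Relation.Binary.PropositionalEquality using (_≡_)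
open import Relation.Nullary using (¬_)

data Step : Set where
  E N : Step

countN : List Step → ℕ
countN List.[] = 0
countN (E List.∷ s) = countN s
countN (N List.∷ s) = suc (countN s)

height : ∀ {n} → Vec Step n → ℕ → ℕ
height w j = countN (take j (toList w))

point : ∀ {n} → Vec Step n → ℕ → ℕ × ℕ
point w j = (j ∸ height w j , height w j)

Below : ∀ {n} → Vec Step n → Vec Step n → Set
Below {n} A B = ∀ j → j ≤ n → height A j ≤ height B j

-- number of lattice points lying on both paths (including both endpoints):
-- the lattice points of a path of length n are point w j for j = 0..n,
-- and a lattice point (x,y) can only be reached after x+y steps.
numCommon : ∀ {n} → Vec Step n → Vec Step n → ℕ
numCommon {n} A B = length (filter (λ j → ≡-dec _≟_ _≟_ (point A j) (point B j)) (upTo (suc n)))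

pathOf : ∀ {n} → Subset n → Vec Step n
pathOf = map (λ { true → N ; false → E })

IsBasis : ∀ {n} (r : ℕ) → Vec Step n → Vec Step n → Subset n → Set
IsBasis r P Q B = (∣ B ∣ ≡ r) × Below P (pathOf B) × Below (pathOf B) Q

indicator : ∀ {n} → Subset n → Fin n → ℚ
indicator B i with lookup B i
... | true = 1ℚ
... | false = 0ℚ

sumFin : ∀ {d} → (Fin d → ℚ) → ℚ
sumFin {zero} f = 0ℚ
sumFin {suc d} f = f zero +ℚ sumFin (λ i → f (suc i))

InConvHull : ∀ {n} → ((Fin n → ℚ) → Set) → (Fin n → ℚ) → Set
InConvHull {n} S x =
  Σ ℕ λ d → Σ (Fin d → (Fin n → ℚ)) λ v → Σ (Fin d → ℚ) λ w →
    (∀ i → S (v i)) × (∀ i → 0ℚ ≤ℚ w i) × (sumFin w ≡ 1ℚ) ×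
    (∀ c → x c ≡ sumFin (λ i → w i *ℚ v i c))

MatroidPolytope : ∀ {n} (r : ℕ) → Vec Step n → Vec Step n → (Fin n → ℚ) → Set
MatroidPolytope {n} r P Q =
  InConvHull (λ x → Σ (Subset n) λ B → IsBasis r P Q B × (∀ c → x c ≡ indicator B c))

AffinelyIndependent : ∀ {n d} → (Fin d → (Fin n → ℚ)) → Set
AffinelyIndependent {n} {d} v =
  ∀ (λs : Fin d → ℚ) → sumFin λs ≡ 0ℚ → (∀ c → sumFin (λ i → λs i *ℚ v i c) ≡ 0ℚ) →
    ∀ i → λs i ≡ 0ℚ

-- a set S ⊆ ℚ^n has (affine) dimension d: its affine hull has dimension d,
-- i.e. S contains d+1 affinely independent points but not d+2.
HasDimension : ∀ {n} → ((Fin n → ℚ) → Set) → ℕ → Set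
HasDimension {n} S d =
  (Σ (Fin (suc d) → (Fin n → ℚ)) λ v → (∀ i → S (v i)) × AffinelyIndependent v) ×
  (∀ (v : Fin (suc (suc d)) → (Fin n → ℚ)) → (∀ i → S (v i)) → ¬ AffinelyIndependent v)

module Submission where

-- Write h_X(j) for the height of a path X after j steps.  A subset B is a basis of
-- M[P,Q] exactly when its path has profile h_B with h_P ≤ h_B ≤ h_Q, and the j-th
-- prefix sum of the indicator vector e_B equals h_B(j).  Let k be the number of
-- positions j ∈ [0,n] where P and Q meet, and d = n + 1 − k.
--
-- At a meeting position j every basis has h_B(j) = h_Q(j), so the j-th
-- prefix sum is constant on the polytope.  Given d + 2 points, the d + 1 linear
-- conditions "coefficients sum to 0" and "j-th prefix sum vanishes" (j an apart
-- position, i.e. one where P and Q do not meet) have a nontrivial solution; the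
-- resulting combination has all prefix sums zero, hence is zero, so the points are
-- affinely dependent.
--
-- For each apart position j the "dented" profile
-- i ↦ min(h_Q(i), h_Q(j) − 1 + (i ∸ j)) is a basis touching Q everywhere except on a
-- stretch around j.  Together with Q itself these d + 1 bases are affinely
-- independent: relative to Q, their profile deficits form a triangular system with
-- nonzero diagonal once the positions are ranked by 2 h_Q(j) + (n − j).

open import Defs
open import Data.Nat using (ℕ; zero; suc; _+_; _∸_; _≤_; _<_; z≤n; s≤s; _⊓_)
import Data.Nat as ℕ
import Data.Nat.Properties as ℕP
open import Data.Rational as ℚ using (ℚ; 0ℚ; 1ℚ; 1/_)
  renaming (_+_ to _+ℚ_; _*_ to _*ℚ_; -_ to -ℚ_; _-_ to _-ℚ_)
import Data.Rational.Properties as ℚP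
open import Data.Rational.Solver using (module +-*-Solver)
open +-*-Solver using (solve; _:+_; _:*_; :-_; _:=_; con)
open import Data.Nat.Tactic.RingSolver using (solve-∀)
open import Data.Bool using (Bool; true; false; T)
open import Data.Vec as Vec using (Vec; []; _∷_)
open import Data.Fin using (Fin; zero; suc; punchIn)
import Data.Fin.Properties as FinP
open import Data.Fin.Subset using (Subset; ∣_∣)
open import Data.Vec.Functional using (insertAt)
open import Data.Vec.Functional.Properties using (insertAt-lookup; insertAt-punchIn)
open import Data.List as List using (List; []; _∷_; length; filter; upTo)
import Data.List.Properties as ListP
open import Data.List.Relation.Unary.All as All using (All; []; _∷_)
import Data.List.Relation.Unary.All.Properties as AllP
open import Data.List.Relation.Unary.AllPairs using (_∷_)
open import Data.List.Relation.Unary.Unique.Propositional using (Unique)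
import Data.List.Relation.Unary.Unique.Propositional.Properties as UniqueP
open import Data.List.Membership.Propositional using (_∈_)
open import Data.List.Membership.Propositional.Properties
  using (∈-lookup; ∈-filter⁺; ∈-filter⁻; ∈-upTo⁺; ∈-upTo⁻)
open import Data.Product using (Σ; _×_; _,_; proj₁; proj₂)
open import Data.Product.Properties using (≡-dec)
open import Data.Sum using (_⊎_; inj₁; inj₂)
open import Data.Empty using (⊥-elim)
open import Data.Unit using (tt)
open import Function using (_∘_)
open import Relation.Nullary using (¬_; Dec; yes; no; ¬?; does)
open import Relation.Nullary.Decidable using (toWitness; decidable-stable)
open import Relation.Unary using (Decidable)
open import Relation.Binary.Definitions using (tri<; tri≈; tri>)
open import Relation.Binary.PropositionalEquality
  using (_≡_; _≢_; refl; sym; trans; cong; cong₂; subst; module ≡-Reasoning)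

sumFin-cong : ∀ {d} {f g : Fin d → ℚ} → (∀ i → f i ≡ g i) → sumFin f ≡ sumFin g
sumFin-cong {zero} f≡g = refl
sumFin-cong {suc d} f≡g = cong₂ _+ℚ_ (f≡g zero) (sumFin-cong (f≡g ∘ suc))

sumFin-zero : ∀ d → sumFin {d} (λ _ → 0ℚ) ≡ 0ℚ
sumFin-zero zero = refl
sumFin-zero (suc d) = trans (ℚP.+-identityˡ _) (sumFin-zero d)

sumFin-+ : ∀ {d} (f g : Fin d → ℚ) → sumFin (λ i → f i +ℚ g i) ≡ sumFin f +ℚ sumFin g
sumFin-+ {zero} f g = refl
sumFin-+ {suc d} f g =
  trans (cong (f zero +ℚ g zero +ℚ_) (sumFin-+ (f ∘ suc) (g ∘ suc)))
        (solve 4 (λ a b c e → (a :+ b) :+ (c :+ e) := (a :+ c) :+ (b :+ e)) refl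
               (f zero) (g zero) (sumFin (f ∘ suc)) (sumFin (g ∘ suc)))

sumFin-scale : ∀ {d} (a : ℚ) (f : Fin d → ℚ) → sumFin (λ i → a *ℚ f i) ≡ a *ℚ sumFin f
sumFin-scale {zero} a f = sym (ℚP.*-zeroʳ a)
sumFin-scale {suc d} a f =
  trans (cong (a *ℚ f zero +ℚ_) (sumFin-scale a (f ∘ suc)))
        (sym (ℚP.*-distribˡ-+ a (f zero) (sumFin (f ∘ suc))))

sumFin-punchIn : ∀ {u} (f : Fin (suc u) → ℚ) p → sumFin f ≡ f p +ℚ sumFin (f ∘ punchIn p)
sumFin-punchIn f zero = refl
sumFin-punchIn {suc u} f (suc p) =
  trans (cong (f zero +ℚ_) (sumFin-punchIn (f ∘ suc) p))
        (solve 3 (λ a b c → a :+ (b :+ c) := b :+ (a :+ c)) refl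
               (f zero) (f (suc p)) (sumFin (f ∘ suc ∘ punchIn p)))

sumFin-only : ∀ {d} (f : Fin d → ℚ) p → (∀ q → q ≢ p → f q ≡ 0ℚ) → sumFin f ≡ f p
sumFin-only {suc u} f p others = begin
  sumFin f                                 ≡⟨ sumFin-punchIn f p ⟩
  f p +ℚ sumFin (f ∘ punchIn p)            ≡⟨ cong (f p +ℚ_) (sumFin-cong vanish) ⟩
  f p +ℚ sumFin {u} (λ _ → 0ℚ)             ≡⟨ cong (f p +ℚ_) (sumFin-zero u) ⟩
  f p +ℚ 0ℚ                                ≡⟨ ℚP.+-identityʳ (f p) ⟩
  f p                                      ∎
  where
  open ≡-Reasoning
  vanish : ∀ i → f (punchIn p i) ≡ 0ℚ
  vanish i = others (punchIn p i) (FinP.punchInᵢ≢i p i)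

sumFin-relative : ∀ {d} (λs f : Fin (suc d) → ℚ) → sumFin λs ≡ 0ℚ →
  sumFin (λ t → λs t *ℚ f t) ≡ sumFin (λ s → λs (suc s) *ℚ (f (suc s) -ℚ f zero))
sumFin-relative λs f Σλ≡0 = begin
  λ₀ *ℚ f₀ +ℚ A                          ≡⟨ solve 4 (λ l x a l' → l :* x :+ a
                                                  := (a :+ (:- x) :* l') :+ x :* (l :+ l'))
                                                  refl λ₀ f₀ A Λ ⟩
  (A +ℚ (-ℚ f₀) *ℚ Λ) +ℚ f₀ *ℚ sumFin λs ≡⟨ cong (λ z → (A +ℚ (-ℚ f₀) *ℚ Λ) +ℚ f₀ *ℚ z) Σλ≡0 ⟩
  (A +ℚ (-ℚ f₀) *ℚ Λ) +ℚ f₀ *ℚ 0ℚ       ≡⟨ solve 3 (λ a x l' → (a :+ (:- x) :* l') :+ x :* con 0ℚ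
                                                  := a :+ (:- x) :* l') refl A f₀ Λ ⟩
  A +ℚ (-ℚ f₀) *ℚ Λ                      ≡⟨ cong (A +ℚ_) (sym (sumFin-scale (-ℚ f₀) (λs ∘ suc))) ⟩
  A +ℚ sumFin (λ s → (-ℚ f₀) *ℚ λs (suc s))
                                         ≡⟨ sym (sumFin-+ (λ s → λs (suc s) *ℚ f (suc s)) (λ s → (-ℚ f₀) *ℚ λs (suc s))) ⟩
  sumFin (λ s → λs (suc s) *ℚ f (suc s) +ℚ (-ℚ f₀) *ℚ λs (suc s))
                                         ≡⟨ sumFin-cong (λ s → solve 3 (λ l x y → l :* x :+ (:- y) :* l
                                                  := l :* (x :+ (:- y))) refl (λs (suc s)) (f (suc s)) f₀) ⟩
  sumFin (λ s → λs (suc s) *ℚ (f (suc s) -ℚ f₀)) ∎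
  where
  open ≡-Reasoning
  λ₀ = λs zero
  f₀ = f zero
  A = sumFin (λ s → λs (suc s) *ℚ f (suc s))
  Λ = sumFin (λs ∘ suc)

*-eliminateʳ : ∀ {a b : ℚ} → a *ℚ b ≡ 0ℚ → b ≢ 0ℚ → a ≡ 0ℚ
*-eliminateʳ {a} {b} ab≡0 b≢0 = begin
  a                    ≡⟨ sym (ℚP.*-identityʳ a) ⟩
  a *ℚ 1ℚ              ≡⟨ cong (a *ℚ_) (sym (ℚP.*-inverseʳ b {{b≠0}})) ⟩
  a *ℚ (b *ℚ b⁻¹)      ≡⟨ sym (ℚP.*-assoc a b b⁻¹) ⟩
  (a *ℚ b) *ℚ b⁻¹      ≡⟨ cong (_*ℚ b⁻¹) ab≡0 ⟩
  0ℚ *ℚ b⁻¹            ≡⟨ ℚP.*-zeroˡ b⁻¹ ⟩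
  0ℚ                   ∎
  where
  open ≡-Reasoning
  b≠0 : ℚ.NonZero b
  b≠0 = ℚ.≢-nonZero b≢0
  b⁻¹ : ℚ
  b⁻¹ = (1/ b) {{b≠0}}

dot : ∀ {u} → (Fin u → ℚ) → (Fin u → ℚ) → ℚ
dot a x = sumFin (λ i → x i *ℚ a i)

dot-zero : ∀ {u} (f : Fin u → ℚ) y → (∀ i → f i ≡ 0ℚ) → dot f y ≡ 0ℚ
dot-zero {u} f y f≡0 =
  trans (sumFin-cong (λ i → trans (cong (y i *ℚ_) (f≡0 i)) (ℚP.*-zeroʳ (y i)))) (sumFin-zero u)

NontrivialRoot : ∀ u → List (Fin u → ℚ) → Set
NontrivialRoot u eqs =
  Σ (Fin u → ℚ) λ x → (Σ (Fin u) λ i → x i ≢ 0ℚ) × All (λ a → dot a x ≡ 0ℚ) eqs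

-- Gaussian elimination of one unknown.  Given a form a with pivot p (a p ≠ 0), every
-- form b is replaced by a form in the remaining unknowns, and a root y of the reduced
-- forms is extended to a root of the original forms by solving a = 0 for x_p.
module Elimination {u : ℕ} (a : Fin (suc u) → ℚ) (p : Fin (suc u)) where

  restrict : (Fin (suc u) → ℚ) → Fin u → ℚ
  restrict b = b ∘ punchIn p

  eliminate : (Fin (suc u) → ℚ) → Fin u → ℚ
  eliminate b i = a p *ℚ restrict b i +ℚ (-ℚ (b p *ℚ restrict a i))

  extend : (Fin u → ℚ) → Fin (suc u) → ℚ
  extend y = insertAt (λ i → a p *ℚ y i) p (-ℚ dot (restrict a) y)

  -- Both sides equal a_p · (b'·y) − b_p · (a'·y), where ' denotes restriction.
  dot-extend : ∀ b y → dot b (extend y) ≡ dot (eliminate b) y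
  dot-extend b y = begin
    dot b (extend y)
      ≡⟨ sumFin-punchIn (λ i → extend y i *ℚ b i) p ⟩
    extend y p *ℚ b p +ℚ sumFin (λ i → extend y (punchIn p i) *ℚ restrict b i)
      ≡⟨ cong₂ (λ z w → z *ℚ b p +ℚ w) (insertAt-lookup ay p (-ℚ Sa))
               (sumFin-cong (λ i → cong (_*ℚ restrict b i) (insertAt-punchIn ay p (-ℚ Sa) i))) ⟩
    (-ℚ Sa) *ℚ b p +ℚ sumFin (λ i → (a p *ℚ y i) *ℚ restrict b i)
      ≡⟨ cong ((-ℚ Sa) *ℚ b p +ℚ_) (trans (sumFin-cong (λ i → ℚP.*-assoc (a p) (y i) (restrict b i)))
                                         (sumFin-scale (a p) (λ i → y i *ℚ restrict b i))) ⟩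
    (-ℚ Sa) *ℚ b p +ℚ a p *ℚ Sb
      ≡⟨ solve 4 (λ s q c t → (:- s) :* c :+ q :* t := q :* t :+ (:- c) :* s) refl Sa (a p) (b p) Sb ⟩
    a p *ℚ Sb +ℚ (-ℚ b p) *ℚ Sa
      ≡⟨ sym (cong₂ _+ℚ_ (sumFin-scale (a p) (λ i → y i *ℚ restrict b i))
                         (sumFin-scale (-ℚ b p) (λ i → y i *ℚ restrict a i))) ⟩
    sumFin (λ i → a p *ℚ (y i *ℚ restrict b i)) +ℚ sumFin (λ i → (-ℚ b p) *ℚ (y i *ℚ restrict a i))
      ≡⟨ sym (sumFin-+ (λ i → a p *ℚ (y i *ℚ restrict b i)) (λ i → (-ℚ b p) *ℚ (y i *ℚ restrict a i))) ⟩
    sumFin (λ i → a p *ℚ (y i *ℚ restrict b i) +ℚ (-ℚ b p) *ℚ (y i *ℚ restrict a i))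
      ≡⟨ sumFin-cong (λ i → solve 5 (λ yi q c bp ai → q :* (yi :* c) :+ (:- bp) :* (yi :* ai)
                                         := yi :* (q :* c :+ (:- (bp :* ai))))
                                     refl (y i) (a p) (restrict b i) (b p) (restrict a i)) ⟩
    dot (eliminate b) y ∎
    where
    open ≡-Reasoning
    ay : Fin u → ℚ
    ay i = a p *ℚ y i
    Sa Sb : ℚ
    Sa = dot (restrict a) y
    Sb = dot (restrict b) y

  eliminate-self : ∀ i → eliminate a i ≡ 0ℚ
  eliminate-self i = solve 2 (λ q c → q :* c :+ (:- (q :* c)) := con 0ℚ) refl (a p) (restrict a i)

-- Outer induction on the number of unknowns (eliminating a pivot), inner induction on
-- the list of equations (discarding zero forms).
homogeneousRoot : ∀ u (eqs : List (Fin u → ℚ)) → length eqs < u → NontrivialRoot u eqs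
homogeneousRoot zero eqs ()
homogeneousRoot (suc u) = rootOf
  where
  rootOf : (eqs : List (Fin (suc u) → ℚ)) → length eqs < suc u → NontrivialRoot (suc u) eqs
  rootOf [] _ = (λ _ → 1ℚ) , (zero , λ ()) , []
  rootOf (a ∷ eqs) (s≤s eqs<u) with FinP.any? (λ p → ¬? (a p ℚ.≟ 0ℚ))
  ... | no noPivot =
    let (x , nonzero , roots) = rootOf eqs (ℕP.m<n⇒m<1+n eqs<u)
    in  x , nonzero , dot-zero a x a≡0 ∷ roots
    where
    a≡0 : ∀ p → a p ≡ 0ℚ
    a≡0 p = decidable-stable (a p ℚ.≟ 0ℚ) (λ ap≢0 → noPivot (p , ap≢0))
  ... | yes (p , ap≢0) =
    let (y , (i , yi≢0) , roots) = homogeneousRoot u (List.map eliminate eqs) reduced<u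
    in  extend y , (punchIn p i , extend-nonzero y i yi≢0) ,
        trans (dot-extend a y) (dot-zero (eliminate a) y eliminate-self) ∷
        All.map (λ {b} root → trans (dot-extend b y) root) (AllP.map⁻ roots)
    where
    open Elimination a p
    reduced<u : length (List.map eliminate eqs) < u
    reduced<u = subst (_< u) (sym (ListP.length-map eliminate eqs)) eqs<u
    extend-nonzero : ∀ y i → y i ≢ 0ℚ → extend y (punchIn p i) ≢ 0ℚ
    extend-nonzero y i yi≢0 ext≡0 =
      ap≢0 (*-eliminateʳ (trans (sym (insertAt-punchIn (λ i → a p *ℚ y i) p _ i)) ext≡0) yi≢0)

triangularSystem-trivial : ∀ {d} (w : Fin d → Fin d → ℚ) (rank : Fin d → ℕ) →
  (∀ s → w s s ≢ 0ℚ) → (∀ q s → q ≢ s → w q s ≡ 0ℚ ⊎ rank q < rank s) →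
  (μ : Fin d → ℚ) → (∀ s → sumFin (λ q → μ q *ℚ w q s) ≡ 0ℚ) → ∀ s → μ s ≡ 0ℚ
triangularSystem-trivial w rank diagonal triangular μ equations s = below (suc (rank s)) s ℕP.≤-refl
  where
  below : ∀ M s → rank s < M → μ s ≡ 0ℚ
  below (suc M) s (s≤s rank≤M) = *-eliminateʳ (trans (sym single) (equations s)) (diagonal s)
    where
    offDiagonal : ∀ q → q ≢ s → μ q *ℚ w q s ≡ 0ℚ
    offDiagonal q q≢s with triangular q s q≢s
    ... | inj₁ wqs≡0 = trans (cong (μ q *ℚ_) wqs≡0) (ℚP.*-zeroʳ (μ q))
    ... | inj₂ q<s = trans (cong (_*ℚ w q s) (below M q (ℕP.<-≤-trans q<s rank≤M))) (ℚP.*-zeroˡ (w q s))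
    single : sumFin (λ q → μ q *ℚ w q s) ≡ μ s *ℚ w s s
    single = sumFin-only (λ q → μ q *ℚ w q s) s offDiagonal

-- psum x j = x₀ + … + x_{j−1} (the whole sum once j ≥ n).
psum : ∀ {n} → (Fin n → ℚ) → ℕ → ℚ
psum {zero} x j = 0ℚ
psum {suc n} x zero = 0ℚ
psum {suc n} x (suc j) = x zero +ℚ psum (x ∘ suc) j

psum-empty : ∀ {n} (x : Fin n → ℚ) → psum x 0 ≡ 0ℚ
psum-empty {zero} x = refl
psum-empty {suc n} x = refl

psum-cong : ∀ {n} {x y : Fin n → ℚ} → (∀ c → x c ≡ y c) → ∀ j → psum x j ≡ psum y j
psum-cong {zero} x≡y j = refl
psum-cong {suc n} x≡y zero = refl
psum-cong {suc n} x≡y (suc j) = cong₂ _+ℚ_ (x≡y zero) (psum-cong (x≡y ∘ suc) j)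

psum-zero : ∀ {n} j → psum {n} (λ _ → 0ℚ) j ≡ 0ℚ
psum-zero {zero} j = refl
psum-zero {suc n} zero = refl
psum-zero {suc n} (suc j) = trans (ℚP.+-identityˡ _) (psum-zero {n} j)

psum-+ : ∀ {n} (x y : Fin n → ℚ) j → psum (λ c → x c +ℚ y c) j ≡ psum x j +ℚ psum y j
psum-+ {zero} x y j = refl
psum-+ {suc n} x y zero = refl
psum-+ {suc n} x y (suc j) =
  trans (cong (x zero +ℚ y zero +ℚ_) (psum-+ (x ∘ suc) (y ∘ suc) j))
        (solve 4 (λ a b c e → (a :+ b) :+ (c :+ e) := (a :+ c) :+ (b :+ e)) refl
               (x zero) (y zero) (psum (x ∘ suc) j) (psum (y ∘ suc) j))

psum-scale : ∀ {n} (a : ℚ) (x : Fin n → ℚ) j → psum (λ c → a *ℚ x c) j ≡ a *ℚ psum x j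
psum-scale {zero} a x j = sym (ℚP.*-zeroʳ a)
psum-scale {suc n} a x zero = sym (ℚP.*-zeroʳ a)
psum-scale {suc n} a x (suc j) =
  trans (cong (a *ℚ x zero +ℚ_) (psum-scale a (x ∘ suc) j))
        (sym (ℚP.*-distribˡ-+ a (x zero) (psum (x ∘ suc) j)))

psum-linear : ∀ {n d} (a : Fin d → ℚ) (v : Fin d → Fin n → ℚ) j →
  psum (λ c → sumFin (λ t → a t *ℚ v t c)) j ≡ sumFin (λ t → a t *ℚ psum (v t) j)
psum-linear {n} {zero} a v j = psum-zero {n} j
psum-linear {n} {suc d} a v j =
  trans (psum-+ (λ c → a zero *ℚ v zero c) (λ c → sumFin (λ t → a (suc t) *ℚ v (suc t) c)) j)
        (cong₂ _+ℚ_ (psum-scale (a zero) (v zero) j) (psum-linear (a ∘ suc) (v ∘ suc) j))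

psum-zero⇒zero : ∀ {n} (y : Fin n → ℚ) → (∀ j → j ≤ n → psum y j ≡ 0ℚ) → ∀ c → y c ≡ 0ℚ
psum-zero⇒zero {suc n} y sums≡0 = vanish
  where
  y₀≡0 : y zero ≡ 0ℚ
  y₀≡0 = begin
    y zero                          ≡⟨ sym (ℚP.+-identityʳ (y zero)) ⟩
    y zero +ℚ 0ℚ                    ≡⟨ cong (y zero +ℚ_) (sym (psum-empty (y ∘ suc))) ⟩
    psum y 1                        ≡⟨ sums≡0 1 (s≤s z≤n) ⟩
    0ℚ                              ∎
    where open ≡-Reasoning
  tail-sums≡0 : ∀ j → j ≤ n → psum (y ∘ suc) j ≡ 0ℚ
  tail-sums≡0 j j≤n = trans (sym (ℚP.+-identityˡ _))
    (trans (cong (_+ℚ psum (y ∘ suc) j) (sym y₀≡0)) (sums≡0 (suc j) (s≤s j≤n)))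
  vanish : ∀ c → y c ≡ 0ℚ
  vanish zero = y₀≡0
  vanish (suc c) = psum-zero⇒zero (y ∘ suc) tail-sums≡0 c

psum-convexHull : ∀ {n} {S : (Fin n → ℚ) → Set} j k → (∀ x → S x → psum x j ≡ k) →
  ∀ x → InConvHull S x → psum x j ≡ k
psum-convexHull j k onS x (d , v , w , v∈S , _ , Σw≡1 , x≡Σwv) = begin
  psum x j                                    ≡⟨ psum-cong x≡Σwv j ⟩
  psum (λ c → sumFin (λ i → w i *ℚ v i c)) j  ≡⟨ psum-linear w v j ⟩
  sumFin (λ i → w i *ℚ psum (v i) j)          ≡⟨ sumFin-cong (λ i → trans (cong (w i *ℚ_) (onS (v i) (v∈S i)))
                                                                          (ℚP.*-comm (w i) k)) ⟩
  sumFin (λ i → k *ℚ w i)                     ≡⟨ sumFin-scale k w ⟩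
  k *ℚ sumFin w                               ≡⟨ cong (k *ℚ_) Σw≡1 ⟩
  k *ℚ 1ℚ                                     ≡⟨ ℚP.*-identityʳ k ⟩
  k                                           ∎
  where open ≡-Reasoning

-- If, outside a list L of free positions, every prefix sum is
-- constant on S, then S contains no (length L + 2) affinely independent points: the
-- length L + 1 conditions "coefficients sum to zero" and "the j-th prefix sum of the
-- combination vanishes" (j ∈ L) have a nontrivial solution, and that combination has
-- all prefix sums zero, hence is the zero vector.
boundedAffineRank : ∀ {n d} (S : (Fin n → ℚ) → Set) (L : List ℕ) → length L ≤ d →
  (∀ j → j ≤ n → j ∈ L ⊎ (∀ x y → S x → S y → psum x j ≡ psum y j)) →
  (v : Fin (suc (suc d)) → Fin n → ℚ) → (∀ t → S (v t)) → ¬ AffinelyIndependent v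
boundedAffineRank {n} {d} S L L≤d freeOrFixed v v∈S independent =
  let (λs , (t , λt≢0) , roots) = homogeneousRoot (suc (suc d)) equations fewer
      Σλ≡0 = trans (sumFin-cong (λ t → sym (ℚP.*-identityʳ (λs t)))) (All.head roots)
  in  λt≢0 (independent λs Σλ≡0 (combination≡0 λs Σλ≡0 (AllP.map⁻ (All.tail roots))) t)
  where
  prefixForm : ℕ → Fin (suc (suc d)) → ℚ
  prefixForm j t = psum (v t) j
  equations : List (Fin (suc (suc d)) → ℚ)
  equations = (λ _ → 1ℚ) ∷ List.map prefixForm L
  fewer : length equations < suc (suc d)
  fewer = s≤s (s≤s (subst (_≤ d) (sym (ListP.length-map prefixForm L)) L≤d))
  combination≡0 : ∀ λs → sumFin λs ≡ 0ℚ → All (λ j → dot (prefixForm j) λs ≡ 0ℚ) L →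
    ∀ c → sumFin (λ t → λs t *ℚ v t c) ≡ 0ℚ
  combination≡0 λs Σλ≡0 free≡0 = psum-zero⇒zero _ prefix≡0
    where
    prefix≡0 : ∀ j → j ≤ n → psum (λ c → sumFin (λ t → λs t *ℚ v t c)) j ≡ 0ℚ
    prefix≡0 j j≤n with freeOrFixed j j≤n
    ... | inj₁ j∈L = trans (psum-linear λs v j) (All.lookup free≡0 j∈L)
    ... | inj₂ fixed = begin
      psum (λ c → sumFin (λ t → λs t *ℚ v t c)) j ≡⟨ psum-linear λs v j ⟩
      sumFin (λ t → λs t *ℚ psum (v t) j)         ≡⟨ sumFin-cong (λ t → trans
                                                       (cong (λs t *ℚ_) (fixed (v t) (v zero) (v∈S t) (v∈S zero)))
                                                       (ℚP.*-comm (λs t) k)) ⟩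
      sumFin (λ t → k *ℚ λs t)                    ≡⟨ sumFin-scale k λs ⟩
      k *ℚ sumFin λs                              ≡⟨ cong (k *ℚ_) Σλ≡0 ⟩
      k *ℚ 0ℚ                                     ≡⟨ ℚP.*-zeroʳ k ⟩
      0ℚ                                          ∎
      where
      open ≡-Reasoning
      k : ℚ
      k = psum (v zero) j

UnitSteps : (ℕ → ℕ) → Set
UnitSteps f = ∀ i → f i ≤ f (suc i) × f (suc i) ≤ suc (f i)

height-unitSteps : ∀ {n} (w : Vec Step n) → UnitSteps (height w)
height-unitSteps [] zero = z≤n , z≤n
height-unitSteps [] (suc i) = z≤n , z≤n
height-unitSteps (E ∷ w) zero = z≤n , z≤n
height-unitSteps (N ∷ w) zero = z≤n , s≤s z≤n
height-unitSteps (E ∷ w) (suc i) = height-unitSteps w i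
height-unitSteps (N ∷ w) (suc i) =
  let (up , atMostOne) = height-unitSteps w i in s≤s up , s≤s atMostOne

unitSteps-rise : ∀ {f} → UnitSteps f → ∀ i k → f i ≤ f (k + i) × f (k + i) ≤ k + f i
unitSteps-rise f-steps i zero = ℕP.≤-refl , ℕP.≤-refl
unitSteps-rise f-steps i (suc k) =
  let (up , atMost) = unitSteps-rise f-steps i k
      (up₁ , atMostOne) = f-steps (k + i)
  in  ℕP.≤-trans up up₁ , ℕP.≤-trans atMostOne (s≤s atMost)

unitSteps-mono : ∀ {f} → UnitSteps f → ∀ {i j} → i ≤ j → f i ≤ f j
unitSteps-mono {f} f-steps {i} {j} i≤j =
  subst (λ z → f i ≤ f z) (ℕP.m∸n+n≡m i≤j) (proj₁ (unitSteps-rise f-steps i (j ∸ i)))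

unitSteps-lipschitz : ∀ {f} → UnitSteps f → ∀ i j → f j ≤ f i + (j ∸ i)
unitSteps-lipschitz {f} f-steps i j with ℕP.≤-total i j
... | inj₁ i≤j = subst (λ z → f z ≤ f i + (j ∸ i)) (ℕP.m∸n+n≡m i≤j)
                   (subst (f ((j ∸ i) + i) ≤_) (ℕP.+-comm (j ∸ i) (f i))
                     (proj₂ (unitSteps-rise f-steps i (j ∸ i))))
... | inj₂ j≤i = ℕP.≤-trans (unitSteps-mono f-steps j≤i) (ℕP.m≤m+n (f i) (j ∸ i))

unitSteps-⊓ : ∀ {f g} → UnitSteps f → UnitSteps g → UnitSteps (λ i → f i ⊓ g i)
unitSteps-⊓ f-steps g-steps i =
  let (f-up , f-one) = f-steps i
      (g-up , g-one) = g-steps i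
  in  ℕP.⊓-mono-≤ f-up g-up , ℕP.⊓-mono-≤ f-one g-one

unitSteps-shift : ∀ c {f} → UnitSteps f → UnitSteps (λ i → c + f i)
unitSteps-shift c {f} f-steps i =
  let (up , atMostOne) = f-steps i
  in  ℕP.+-monoʳ-≤ c up , subst (c + f (suc i) ≤_) (ℕP.+-suc c (f i)) (ℕP.+-monoʳ-≤ c atMostOne)

unitSteps-∸ : ∀ j → UnitSteps (_∸ j)
unitSteps-∸ zero i = ℕP.n≤1+n i , ℕP.≤-refl
unitSteps-∸ (suc j) zero = z≤n , ℕP.≤-trans (ℕP.≤-reflexive (ℕP.0∸n≡0 j)) z≤n
unitSteps-∸ (suc j) (suc i) = unitSteps-∸ j i

pathWithProfile : (n : ℕ) → (ℕ → ℕ) → Subset n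
pathWithProfile zero g = []
pathWithProfile (suc n) g = (g 1 ℕ.≡ᵇ suc (g 0)) ∷ pathWithProfile n (g ∘ suc)

flat-unless-climb : ∀ {a b} → a ≤ b → b ≤ suc a → b ≢ suc a → b ≡ a
flat-unless-climb a≤b b≤1+a b≢1+a with ℕP.m≤n⇒m<n∨m≡n a≤b
... | inj₁ a<b = ⊥-elim (b≢1+a (ℕP.≤-antisym b≤1+a a<b))
... | inj₂ a≡b = sym a≡b

height-pathWithProfile : ∀ n {g} → UnitSteps g → ∀ i → i ≤ n →
  height (pathOf (pathWithProfile n g)) i + g 0 ≡ g i
height-pathWithProfile n g-steps zero _ = refl
height-pathWithProfile (suc n) {g} g-steps (suc i) (s≤s i≤n)
  with g 1 ℕ.≡ᵇ suc (g 0) in climbBit | height-pathWithProfile n (g-steps ∘ suc) i i≤n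
... | true | rest = trans (sym (ℕP.+-suc h (g 0))) (trans (cong (h +_) (sym climb)) rest)
  where
  h : ℕ
  h = height (pathOf (pathWithProfile n (g ∘ suc))) i
  climb : g 1 ≡ suc (g 0)
  climb = ℕP.≡ᵇ⇒≡ (g 1) (suc (g 0)) (subst T (sym climbBit) tt)
... | false | rest = trans (cong (h +_) (sym flat)) rest
  where
  h : ℕ
  h = height (pathOf (pathWithProfile n (g ∘ suc))) i
  ¬climb : g 1 ≢ suc (g 0)
  ¬climb climb = subst T climbBit (ℕP.≡⇒≡ᵇ (g 1) (suc (g 0)) climb)
  flat : g 1 ≡ g 0
  flat = flat-unless-climb (proj₁ (g-steps 0)) (proj₂ (g-steps 0)) ¬climb

size≡finalHeight : ∀ {n} (B : Subset n) → ∣ B ∣ ≡ height (pathOf B) n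
size≡finalHeight [] = refl
size≡finalHeight (true ∷ B) = cong suc (size≡finalHeight B)
size≡finalHeight (false ∷ B) = size≡finalHeight B

height-pathWithProfile₀ : ∀ n {g} → UnitSteps g → g 0 ≡ 0 → ∀ i → i ≤ n →
  height (pathOf (pathWithProfile n g)) i ≡ g i
height-pathWithProfile₀ n {g} g-steps g0≡0 i i≤n =
  trans (sym (ℕP.+-identityʳ h)) (trans (cong (h +_) (sym g0≡0)) (height-pathWithProfile n g-steps i i≤n))
  where
  h : ℕ
  h = height (pathOf (pathWithProfile n g)) i

basisFromProfile : ∀ {n} (r : ℕ) (P Q : Vec Step n) {g : ℕ → ℕ} → UnitSteps g →
  g 0 ≡ 0 → g n ≡ r → (∀ i → i ≤ n → height P i ≤ g i) → (∀ i → i ≤ n → g i ≤ height Q i) →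
  IsBasis r P Q (pathWithProfile n g)
basisFromProfile {n} r P Q {g} g-steps g0≡0 gn≡r P≤g g≤Q =
  trans (size≡finalHeight (pathWithProfile n g)) (trans (follows n ℕP.≤-refl) gn≡r) ,
  (λ i i≤n → subst (height P i ≤_) (sym (follows i i≤n)) (P≤g i i≤n)) ,
  (λ i i≤n → subst (_≤ height Q i) (sym (follows i i≤n)) (g≤Q i i≤n))
  where
  follows : ∀ i → i ≤ n → height (pathOf (pathWithProfile n g)) i ≡ g i
  follows = height-pathWithProfile₀ n g-steps g0≡0

ι : ℕ → ℚ
ι zero = 0ℚ
ι (suc k) = 1ℚ +ℚ ι k

indicator-suc : ∀ {n} (b : Bool) (B : Subset n) c → indicator (b ∷ B) (suc c) ≡ indicator B c
indicator-suc b B c with Vec.lookup B c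
... | true = refl
... | false = refl

psum-indicator : ∀ {n} (B : Subset n) j → psum (indicator B) j ≡ ι (height (pathOf B) j)
psum-indicator [] zero = refl
psum-indicator [] (suc j) = refl
psum-indicator (b ∷ B) zero = refl
psum-indicator (true ∷ B) (suc j) =
  cong (1ℚ +ℚ_) (trans (psum-cong (indicator-suc true B) j) (psum-indicator B j))
psum-indicator (false ∷ B) (suc j) =
  trans (ℚP.+-identityˡ _) (trans (psum-cong (indicator-suc false B) j) (psum-indicator B j))

basis∈polytope : ∀ {n} (r : ℕ) (P Q : Vec Step n) (B : Subset n) →
  IsBasis r P Q B → MatroidPolytope r P Q (indicator B)
basis∈polytope r P Q B isBasis =
  1 , (λ _ → indicator B) , (λ _ → 1ℚ) , (λ _ → B , isBasis , λ c → refl) ,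
  (λ _ → toWitness {a? = 0ℚ ℚP.≤? 1ℚ} tt) , ℚP.+-identityʳ 1ℚ ,
  (λ c → sym (trans (ℚP.+-identityʳ (1ℚ *ℚ indicator B c)) (ℚP.*-identityˡ (indicator B c))))

∸-split : ∀ {n i j} → j ≤ i → i ≤ n → n ∸ j ≡ (n ∸ i) + (i ∸ j)
∸-split {n} {i} {j} j≤i i≤n = trans (cong (_∸ j) (sym (ℕP.m∸n+n≡m i≤n))) (ℕP.+-∸-assoc (n ∸ i) j≤i)

length-filter-split : ∀ {A : Set} {Pr : A → Set} (Pr? : Decidable Pr) xs →
  length (filter Pr? xs) + length (filter (¬? ∘ Pr?) xs) ≡ length xs
length-filter-split Pr? [] = refl
length-filter-split Pr? (x ∷ xs) with Pr? x
... | yes _ = cong suc (length-filter-split Pr? xs)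
... | no _ = trans (ℕP.+-suc _ _) (cong suc (length-filter-split Pr? xs))

lookup-injective : ∀ {A : Set} {xs : List A} → Unique xs → ∀ i j → List.lookup xs i ≡ List.lookup xs j → i ≡ j
lookup-injective (_ ∷ _) zero zero _ = refl
lookup-injective (x∉xs ∷ _) zero (suc j) eq = ⊥-elim (All.lookup x∉xs (∈-lookup j) eq)
lookup-injective (x∉xs ∷ _) (suc i) zero eq = ⊥-elim (All.lookup x∉xs (∈-lookup i) (sym eq))
lookup-injective (_ ∷ unique) (suc i) (suc j) eq = cong suc (lookup-injective unique i j eq)

module PathPair {n : ℕ} (r : ℕ) (P Q : Vec Step n)
                (P-ends : height P n ≡ r) (Q-ends : height Q n ≡ r) (P≤Q : Below P Q) where

  hP hQ : ℕ → ℕ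
  hP = height P
  hQ = height Q

  meet? : (j : ℕ) → Dec (point P j ≡ point Q j)
  meet? j = ≡-dec ℕ._≟_ ℕ._≟_ (point P j) (point Q j)

  apart : List ℕ
  apart = filter (¬? ∘ meet?) (upTo (suc n))

  apart-length : length apart ≡ suc n ∸ numCommon P Q
  apart-length = begin
    length apart                                         ≡⟨ sym (ℕP.m+n∸m≡n (numCommon P Q) (length apart)) ⟩
    (numCommon P Q + length apart) ∸ numCommon P Q       ≡⟨ cong (_∸ numCommon P Q) (length-filter-split meet? (upTo (suc n))) ⟩
    length (upTo (suc n)) ∸ numCommon P Q                ≡⟨ cong (_∸ numCommon P Q) (ListP.length-upTo (suc n)) ⟩
    suc n ∸ numCommon P Q                                ∎
    where open ≡-Reasoning

  meet⇒sameHeight : ∀ {j} → point P j ≡ point Q j → hP j ≡ hQ j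
  meet⇒sameHeight = cong proj₂

  apart⇒lower : ∀ {j} → j ≤ n → ¬ (point P j ≡ point Q j) → hP j < hQ j
  apart⇒lower {j} j≤n ¬meet = ℕP.≤∧≢⇒< (P≤Q j j≤n) (λ same → ¬meet (cong (λ h → (j ∸ h , h)) same))

  meet⇒psum-fixed : ∀ j → j ≤ n → point P j ≡ point Q j →
    ∀ x → MatroidPolytope r P Q x → psum x j ≡ ι (hQ j)
  meet⇒psum-fixed j j≤n meet = psum-convexHull j (ι (hQ j)) onBases
    where
    onBases : ∀ x → (Σ (Subset n) λ B → IsBasis r P Q B × (∀ c → x c ≡ indicator B c)) →
      psum x j ≡ ι (hQ j)
    onBases x (B , (_ , P≤B , B≤Q) , x≡e_B) =
      trans (psum-cong x≡e_B j) (trans (psum-indicator B j) (cong ι (ℕP.≤-antisym (B≤Q j j≤n)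
        (subst (_≤ height (pathOf B) j) (meet⇒sameHeight {j} meet) (P≤B j j≤n)))))

  upperBound : ∀ (v : Fin (suc (suc (suc n ∸ numCommon P Q))) → Fin n → ℚ) →
    (∀ t → MatroidPolytope r P Q (v t)) → ¬ AffinelyIndependent v
  upperBound = boundedAffineRank (MatroidPolytope r P Q) apart (ℕP.≤-reflexive apart-length) apartOrFixed
    where
    apartOrFixed : ∀ j → j ≤ n → j ∈ apart ⊎
      (∀ x y → MatroidPolytope r P Q x → MatroidPolytope r P Q y → psum x j ≡ psum y j)
    apartOrFixed j j≤n with meet? j
    ... | yes meet = inj₂ (λ x y x∈ y∈ →
      trans (meet⇒psum-fixed j j≤n meet x x∈) (sym (meet⇒psum-fixed j j≤n meet y y∈)))
    ... | no ¬meet = inj₁ (∈-filter⁺ (¬? ∘ meet?) (∈-upTo⁺ (s≤s j≤n)) ¬meet)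

  -- Lower bound.  The dented profile at j follows Q but passes one below Q at j: it is
  -- capped at level h_Q(j) − 1 before j and climbs at full speed after j until it
  -- rejoins Q.
  dent : ℕ → ℕ → ℕ
  dent j i = hQ i ⊓ (ℕ.pred (hQ j) + (i ∸ j))

  -- Ranking of positions that makes the deficits of the dents triangular.
  rank : ℕ → ℕ
  rank i = (hQ i + hQ i) + (n ∸ i)

  -- Where the dent at j differs from Q, Q climbs at full speed from j to i (or stays
  -- level before j); along such a stretch the rank strictly increases.
  steep⇒rank-increases : ∀ {i j} → i ≤ n → j ≤ n → hQ i ≡ hQ j + (i ∸ j) → i ≡ j ⊎ rank j < rank i
  steep⇒rank-increases {i} {j} i≤n j≤n steep with ℕP.<-cmp i j
  ... | tri≈ _ i≡j _ = inj₁ i≡j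
  ... | tri< i<j _ _ = inj₂ (subst (λ h → rank j < (h + h) + (n ∸ i)) (sym level)
                              (ℕP.+-monoʳ-< (hQ j + hQ j) (ℕP.∸-monoʳ-< i<j j≤n)))
    where
    level : hQ i ≡ hQ j
    level = trans steep (trans (cong (hQ j +_) (ℕP.m≤n⇒m∸n≡0 (ℕP.<⇒≤ i<j))) (ℕP.+-identityʳ (hQ j)))
  ... | tri> _ _ j<i = inj₂ (subst (rank j <_) (sym rank-rises) (ℕP.m<m+n (rank j) (ℕP.m<n⇒0<n∸m j<i)))
    where
    open ≡-Reasoning
    rank-rises : rank i ≡ rank j + (i ∸ j)
    rank-rises = begin
      (hQ i + hQ i) + (n ∸ i)
        ≡⟨ cong (λ h → (h + h) + (n ∸ i)) steep ⟩
      ((hQ j + (i ∸ j)) + (hQ j + (i ∸ j))) + (n ∸ i)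
        ≡⟨ regroup (hQ j) (i ∸ j) (n ∸ i) ⟩
      ((hQ j + hQ j) + ((n ∸ i) + (i ∸ j))) + (i ∸ j)
        ≡⟨ cong (λ e → ((hQ j + hQ j) + e) + (i ∸ j)) (sym (∸-split (ℕP.<⇒≤ j<i) i≤n)) ⟩
      rank j + (i ∸ j) ∎
      where
      regroup : ∀ a k e → ((a + k) + (a + k)) + e ≡ ((a + a) + (e + k)) + k
      regroup = solve-∀

  module Dent {j : ℕ} (j≤n : j ≤ n) (P<Q : hP j < hQ j) where

    dentLine : ℕ → ℕ
    dentLine i = ℕ.pred (hQ j) + (i ∸ j)

    -- Q is above P ≥ 0 at j, so h_Q(j) > 0.
    Q-positive : suc (ℕ.pred (hQ j)) ≡ hQ j
    Q-positive = ℕP.suc-pred (hQ j) {{ℕ.>-nonZero (ℕP.<-≤-trans (s≤s z≤n) P<Q)}}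

    unitSteps : UnitSteps (dent j)
    unitSteps = unitSteps-⊓ (height-unitSteps Q) (unitSteps-shift (ℕ.pred (hQ j)) (unitSteps-∸ j))

    P-belowLine : ∀ i → hP i ≤ dentLine i
    P-belowLine i = ℕP.≤-trans (unitSteps-lipschitz (height-unitSteps P) j i)
                                (ℕP.+-monoˡ-≤ (i ∸ j) (ℕP.<⇒≤pred P<Q))

    above-P : ∀ i → i ≤ n → hP i ≤ dent j i
    above-P i i≤n = ℕP.⊓-glb (P≤Q i i≤n) (P-belowLine i)

    below-Q : ∀ i → i ≤ n → dent j i ≤ hQ i
    below-Q i _ = ℕP.m⊓n≤m (hQ i) (dentLine i)

    ends : dent j n ≡ r
    ends = trans (ℕP.m≤n⇒m⊓n≡m (subst (_≤ dentLine n) (trans P-ends (sym Q-ends)) (P-belowLine n))) Q-ends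

    dips : suc (dent j j) ≡ hQ j
    dips = begin
      suc (hQ j ⊓ (ℕ.pred (hQ j) + (j ∸ j))) ≡⟨ cong (λ e → suc (hQ j ⊓ (ℕ.pred (hQ j) + e))) (ℕP.n∸n≡0 j) ⟩
      suc (hQ j ⊓ (ℕ.pred (hQ j) + 0))       ≡⟨ cong (λ e → suc (hQ j ⊓ e)) (ℕP.+-identityʳ (ℕ.pred (hQ j))) ⟩
      suc (hQ j ⊓ ℕ.pred (hQ j))             ≡⟨ cong suc (ℕP.m≥n⇒m⊓n≡n (ℕP.pred[n]≤n {hQ j})) ⟩
      suc (ℕ.pred (hQ j))                    ≡⟨ Q-positive ⟩
      hQ j                                   ∎
      where open ≡-Reasoning

    touches-or-ranks-above : ∀ i → i ≤ n → dent j i ≡ hQ i ⊎ (i ≡ j ⊎ rank j < rank i)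
    touches-or-ranks-above i i≤n with hQ i ℕ.≤? dentLine i
    ... | yes Q≤line = inj₁ (ℕP.m≤n⇒m⊓n≡m Q≤line)
    ... | no Q≰line = inj₂ (steep⇒rank-increases i≤n j≤n steep)
      where
      steep : hQ i ≡ hQ j + (i ∸ j)
      steep = ℕP.≤-antisym (unitSteps-lipschitz (height-unitSteps Q) j i)
                (subst (λ h → h + (i ∸ j) ≤ hQ i) Q-positive (ℕP.≰⇒> Q≰line))

  #apart : ℕ
  #apart = length apart

  position : Fin #apart → ℕ
  position = List.lookup apart

  position-≤ : ∀ s → position s ≤ n
  position-≤ s = ℕP.≤-pred (∈-upTo⁻ (proj₁ (∈-filter⁻ (¬? ∘ meet?) {xs = upTo (suc n)} (∈-lookup {xs = apart} s))))

  position-lower : ∀ s → hP (position s) < hQ (position s)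
  position-lower s = apart⇒lower (position-≤ s) (proj₂ (∈-filter⁻ (¬? ∘ meet?) {xs = upTo (suc n)} (∈-lookup {xs = apart} s)))

  position-injective : ∀ q s → position q ≡ position s → q ≡ s
  position-injective = lookup-injective (UniqueP.filter⁺ (¬? ∘ meet?) (UniqueP.upTo⁺ (suc n)))

  profile : Fin (suc #apart) → ℕ → ℕ
  profile zero = hQ
  profile (suc s) = dent (position s)

  profile-unitSteps : ∀ t → UnitSteps (profile t)
  profile-unitSteps zero = height-unitSteps Q
  profile-unitSteps (suc s) = Dent.unitSteps (position-≤ s) (position-lower s)

  profile-basis : ∀ t → IsBasis r P Q (pathWithProfile n (profile t))
  profile-basis zero = basisFromProfile r P Q (height-unitSteps Q) refl Q-ends P≤Q (λ i _ → ℕP.≤-refl)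
  profile-basis (suc s) = basisFromProfile r P Q unitSteps refl ends above-P below-Q
    where open Dent (position-≤ s) (position-lower s)

  vertex : Fin (suc #apart) → Fin n → ℚ
  vertex t = indicator (pathWithProfile n (profile t))

  psum-vertex : ∀ t i → i ≤ n → psum (vertex t) i ≡ ι (profile t i)
  psum-vertex t i i≤n = trans (psum-indicator (pathWithProfile n (profile t)) i)
    (cong ι (height-pathWithProfile₀ n (profile-unitSteps t) (profile-starts t) i i≤n))
    where
    profile-starts : ∀ t → profile t 0 ≡ 0
    profile-starts zero = refl
    profile-starts (suc s) = refl

  deficit : Fin #apart → Fin #apart → ℚ
  deficit q s = ι (dent (position q) (position s)) -ℚ ι (hQ (position s))

  deficit-diagonal : ∀ s → deficit s s ≢ 0ℚ
  deficit-diagonal s = subst (λ h → ι (dent j j) -ℚ ι h ≢ 0ℚ) (Dent.dips (position-≤ s) (position-lower s))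
    (λ eq → minusOne≢0 (trans (sym (oneBelow (ι (dent j j)))) eq))
    where
    j : ℕ
    j = position s
    oneBelow : ∀ a → a -ℚ (1ℚ +ℚ a) ≡ -ℚ 1ℚ
    oneBelow a = solve 1 (λ a → a :+ (:- (con 1ℚ :+ a)) := :- con 1ℚ) refl a
    minusOne≢0 : -ℚ 1ℚ ≢ 0ℚ
    minusOne≢0 ()

  deficit-triangular : ∀ q s → q ≢ s → deficit q s ≡ 0ℚ ⊎ rank (position q) < rank (position s)
  deficit-triangular q s q≢s
    with Dent.touches-or-ranks-above (position-≤ q) (position-lower q) (position s) (position-≤ s)
  ... | inj₁ touches = inj₁ (trans (cong (λ h → ι h -ℚ ι (hQ (position s))) touches)
                                   (ℚP.+-inverseʳ (ι (hQ (position s)))))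
  ... | inj₂ (inj₁ same) = ⊥-elim (q≢s (sym (position-injective s q same)))
  ... | inj₂ (inj₂ ranks-above) = inj₂ ranks-above

  -- Q together with its dents is affinely independent: relative to Q, any vanishing
  -- affine combination gives a triangular system in the deficits.
  vertices-independent : AffinelyIndependent vertex
  vertices-independent λs Σλ≡0 combination≡0 = λ≡0
    where
    levels : ∀ i → i ≤ n → sumFin (λ t → λs t *ℚ ι (profile t i)) ≡ 0ℚ
    levels i i≤n = begin
      sumFin (λ t → λs t *ℚ ι (profile t i))      ≡⟨ sumFin-cong (λ t → cong (λs t *ℚ_) (sym (psum-vertex t i i≤n))) ⟩
      sumFin (λ t → λs t *ℚ psum (vertex t) i)    ≡⟨ sym (psum-linear λs vertex i) ⟩
      psum (λ c → sumFin (λ t → λs t *ℚ vertex t c)) i ≡⟨ psum-cong combination≡0 i ⟩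
      psum {n} (λ _ → 0ℚ) i                       ≡⟨ psum-zero {n} i ⟩
      0ℚ                                          ∎
      where open ≡-Reasoning
    deficit-equations : ∀ s → sumFin (λ q → λs (suc q) *ℚ deficit q s) ≡ 0ℚ
    deficit-equations s = trans (sym (sumFin-relative λs (λ t → ι (profile t (position s))) Σλ≡0))
                                (levels (position s) (position-≤ s))
    dents≡0 : ∀ s → λs (suc s) ≡ 0ℚ
    dents≡0 = triangularSystem-trivial deficit (rank ∘ position) deficit-diagonal deficit-triangular
                                       (λs ∘ suc) deficit-equations
    λ≡0 : ∀ t → λs t ≡ 0ℚ
    λ≡0 (suc s) = dents≡0 s
    λ≡0 zero = begin
      λs zero                                 ≡⟨ sym (ℚP.+-identityʳ (λs zero)) ⟩
      λs zero +ℚ 0ℚ                           ≡⟨ cong (λs zero +ℚ_) (sym (trans (sumFin-cong dents≡0) (sumFin-zero #apart))) ⟩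
      sumFin λs                               ≡⟨ Σλ≡0 ⟩
      0ℚ                                      ∎
      where open ≡-Reasoning

  IndependentPoints : ℕ → Set
  IndependentPoints d =
    Σ (Fin (suc d) → Fin n → ℚ) λ v → (∀ t → MatroidPolytope r P Q (v t)) × AffinelyIndependent v

  lowerBound : IndependentPoints (suc n ∸ numCommon P Q)
  lowerBound = subst IndependentPoints apart-length
    (vertex , (λ t → basis∈polytope r P Q _ (profile-basis t)) , vertices-independent)

mainTheorem1 : (m r : ℕ) (P Q : Vec Step (m + r)) →
    height P (m + r) ≡ r → height Q (m + r) ≡ r → Below P Q →
    HasDimension (MatroidPolytope r P Q) (suc (m + r) ∸ numCommon P Q)
mainTheorem1 m r P Q P-ends Q-ends P≤Q = lowerBound , upperBound
  where open PathPair r P Q P-ends Q-ends P≤Q
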